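{- Let $q\ge 2$ and $n\ge 1$ be integers, and let $D=\{d_1,\ldots,d_k\}\subseteq\{1,\ldots,n\}$ with $1\le d_1<\cdots<d_k\le n$. Let $G(\mathbb{Z}_q^n,D)$ be the distance graph of $(\mathbb{Z}_q^n,\rho)$ with distance set $D$, where $\rho$ is the RT metric. Define graphs recursively by $H_1=K_q(q^{d_1-1})$ and $H_j=\left[q^{\,d_j-d_{j-1}-1}H_{j-1}\right]^q$ for $j=2,\ldots,k$. Then $$G(\mathbb{Z}_q^n,D)\cong q^{\,n-d_k}H_k,$$ i.e. $G(\mathbb{Z}_q^n,D)\cong q^{n-d_k}\left[q^{d_k-d_{k-1}-1}\left[\cdots\left[q^{d_2-d_1-1}K_q(q^{d_1-1})\right]^q\cdots\right]^q\right]^q$.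
   Context: $\mathbb{Z}_q=\{0,1,\ldots,q-1\}$ (integers mod $q$). For $x=(x_1,\ldots,x_n)\in\mathbb{Z}_q^n$, the RT weight is $\omega(x)=\max\{i: x_i\neq 0\}$ if $x\ne 0$ and $\omega(0)=0$; the RT (Rosenbloom–Tsfasman) distance is $\rho(x,y)=\omega(x-y)$. For a metric space $(X,d)$ and a set $D$ of positive reals, the distance graph $G(X,D)$ has vertex set $X$ and an edge $xy$ for distinct $x,y\in X$ whenever $d(x,y)\in D$. For a graph $G$ and positive integer $m$, $mG$ denotes the disjoint union of $m$ copies of $G$, and $[G]^m$ denotes the join $G+\cdots+G$ of $m$ copies of $G$ (disjoint union of the copies together with all edges between vertices of different copies). $K_r(m)$ denotes the complete $r$-partite graph with every part of size $m$. -}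

module Defs where

open import Data.Nat using (ℕ; zero; suc; _+_; _∸_; _^_; _≤_; _≤ᵇ_; _≡ᵇ_; _⊔_)
open import Data.Fin using (Fin; toℕ)
open import Data.Vec using (Vec; zipWith; lookup; tabulate; toList)
open import Data.List using (foldr)
open import Data.Bool using (if_then_else_)
open import Data.Product using (Σ; _×_)
open import Relation.Binary.PropositionalEquality using (_≡_; _≢_)
open import Function.Bundles using (_↔_; _⇔_; Inverse)

record Graph : Set₁ where
  field
    Vertex : Set
    Adj    : Vertex → Vertex → Set
open Graph public

_≅_ : Graph → Graph → Set
G ≅ H = Σ (Vertex G ↔ Vertex H) λ f →
          ∀ x y → Adj G x y ⇔ Adj H (Inverse.to f x) (Inverse.to f y)

copies : ℕ → Graph → Graph
copies m G = record
  { Vertex = Fin m × Vertex G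
  ; Adj    = λ u v → (Data.Product.proj₁ u ≡ Data.Product.proj₁ v)
                   × Adj G (Data.Product.proj₂ u) (Data.Product.proj₂ v) }

join : ℕ → Graph → Graph
join m G = record
  { Vertex = Fin m × Vertex G
  ; Adj    = λ u v → (Data.Product.proj₁ u ≢ Data.Product.proj₁ v)
                   Data.Sum.⊎ ((Data.Product.proj₁ u ≡ Data.Product.proj₁ v)
                               × Adj G (Data.Product.proj₂ u) (Data.Product.proj₂ v)) }
  where import Data.Sum

completeMultipartite : ℕ → ℕ → Graph
completeMultipartite r m = record
  { Vertex = Fin r × Fin m
  ; Adj    = λ u v → Data.Product.proj₁ u ≢ Data.Product.proj₁ v }

subMod : ℕ → ℕ → ℕ → ℕ
subMod q a b = if b ≤ᵇ a then a ∸ b else (q + a) ∸ b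

vsub : ∀ {q n} → Vec (Fin q) n → Vec (Fin q) n → Vec ℕ n
vsub {q} x y = zipWith (λ a b → subMod q (toℕ a) (toℕ b)) x y

-- RT weight: max { i (1-based) : x_i ≠ 0 }, and 0 for the zero vector
rtWeight : ∀ {n} → Vec ℕ n → ℕ
rtWeight {n} x = foldr _⊔_ 0 (toList (tabulate {n = n}
  λ i → if lookup x i ≡ᵇ 0 then 0 else suc (toℕ i)))

rtDist : ∀ {q n} → Vec (Fin q) n → Vec (Fin q) n → ℕ
rtDist x y = rtWeight (vsub x y)

distanceGraph : (q n : ℕ) (k : ℕ) (d : ℕ → ℕ) → Graph
distanceGraph q n k d = record
  { Vertex = Vec (Fin q) n
  ; Adj    = λ x y → (x ≢ y) × Σ ℕ (λ i → i ≤ k × rtDist x y ≡ d i) }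

-- The graphs H_j (0-based: H q d 0 = H_1, with d 0 = d_1, d 1 = d_2, …)
-- H_1 = K_q(q^(d_1 - 1)),  H_j = [ q^(d_j - d_{j-1} - 1) H_{j-1} ]^q

H : (q : ℕ) (d : ℕ → ℕ) → ℕ → Graph
H q d zero    = completeMultipartite q (q ^ (d 0 ∸ 1))
H q d (suc j) = join q (copies (q ^ (d (suc j) ∸ d j ∸ 1)) (H q d j))

-- Split a word x ∈ ℤ_q^(a+b) into its low block (first a coordinates) and
-- its high block (last b). If the high blocks of x and y agree then
-- ρ(x,y) is the distance of the low blocks, which is at most a; otherwise
-- ρ(x,y) = a + ρ(high x, high y) lies in (a, a+b]. So when D misses
-- (a, a+b] the distance graph is q^b disjoint copies of the graph on the
-- low blocks, and when D contains (a, a+b] it is their q^b-fold join.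
-- Peeling off coordinates from the top, the gap d_j < r < d_(j+1) gives
-- the copies, the coordinate d_(j+1) gives the join, and below d_1 the
-- graph is edgeless, so one join of q edgeless graphs yields K_q(q^(d_1-1)).
module Submission where

open import Defs
open import Data.Bool using (true; false; if_then_else_; T)
open import Data.Empty using (⊥-elim)
open import Data.Fin using (Fin; toℕ; zero) renaming (_≟_ to _≟ᶠ_)
open import Data.Fin.Properties using (toℕ-injective; toℕ<n; *↔×)
open import Data.List using (foldr)
open import Data.Nat using (ℕ; zero; suc; _+_; _∸_; _^_; _≤_; _<_; _⊔_; _≤ᵇ_; _≡ᵇ_; z≤n; s≤s)
open import Data.Nat.Properties
  using (≤-refl; ≤-reflexive; ≤-trans; ≤-antisym; <⇒≤; <⇒≱; <-≤-trans; ≤-<-connex;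
         m≤m+n; m<m+n; +-comm; +-suc; +-monoʳ-≤; *-identityʳ; n∸n≡0; m∸n≡0⇒m≤n; ∸-+-assoc; m+[n∸m]≡n; n≢0⇒n>0; ≤⇒≤ᵇ; ≤ᵇ⇒≤)
open import Data.Product using (Σ; _×_; _,_; proj₁; proj₂; uncurry)
open import Data.Product.Algebra using (×-comm)
open import Data.Product.Function.NonDependent.Propositional using (_×-↔_; _×-⇔_)
open import Data.Sum using (inj₁; inj₂; [_,_])
open import Data.Sum.Function.Propositional using (_⊎-⇔_)
open import Data.Unit using (tt)
open import Data.Vec using (Vec; []; _∷_; _++_; take; drop; lookup; tabulate; toList; uncons)
open import Data.Vec.Properties using (take++drop≡id; ++-injective; ++-injectiveˡ; ++-injectiveʳ; tabulate-cong)
open import Function using (_∘_; id)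
open import Function.Bundles using (_↔_; _⇔_; Inverse; Equivalence; mk↔ₛ′; mk⇔)
open import Function.Properties.Inverse using (↔-refl; ↔-trans; ↔-sym)
import Function.Properties.Equivalence as ⇔
open import Relation.Nullary using (¬_; yes; no)
open import Relation.Binary.PropositionalEquality
  using (_≡_; _≢_; refl; sym; trans; cong; cong₂; subst; subst₂; module ≡-Reasoning)

open Inverse using (to; from; strictlyInverseˡ; strictlyInverseʳ)

-- Unlike the Σ-type _≅_, a record type is injective in its indices, so
-- Agda can infer the graphs when isomorphisms are composed.
record _≃_ (G H : Graph) : Set where
  constructor mk≃
  field
    vertices  : Vertex G ↔ Vertex H
    adjacency : ∀ x y → Adj G x y ⇔ Adj H (to vertices x) (to vertices y)

≃⇒≅ : ∀ {G H} → G ≃ H → G ≅ H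
≃⇒≅ (mk≃ f f-adj) = f , f-adj

≃-trans : ∀ {G H K} → G ≃ H → H ≃ K → G ≃ K
≃-trans (mk≃ f f-adj) (mk≃ g g-adj) =
  mk≃ (↔-trans f g) λ x y → ⇔.trans (f-adj x y) (g-adj (to f x) (to f y))

mk≃′ : ∀ {G H} (f : Vertex G ↔ Vertex H) →
       (∀ u v → Adj G (from f u) (from f v) ⇔ Adj H u v) → G ≃ H
mk≃′ {G} {H} f adj = mk≃ f λ x y →
  subst₂ (λ x′ y′ → Adj G x′ y′ ⇔ Adj H (to f x) (to f y))
         (strictlyInverseʳ f x) (strictlyInverseʳ f y) (adj (to f x) (to f y))

copies-cong : ∀ {G H m} → G ≃ H → copies m G ≃ copies m H
copies-cong (mk≃ f f-adj) = mk≃ (↔-refl ×-↔ f) λ (_ , x) (_ , y) → ⇔.refl ×-⇔ f-adj x y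

join-cong : ∀ {G H m} → G ≃ H → join m G ≃ join m H
join-cong (mk≃ f f-adj) =
  mk≃ (↔-refl ×-↔ f) λ (_ , x) (_ , y) → ⇔.refl ⊎-⇔ (⇔.refl ×-⇔ f-adj x y)

join-edgeless : ∀ {G r m} → Vertex G ↔ Fin m → (∀ x y → ¬ Adj G x y) →
                join r G ≃ completeMultipartite r m
join-edgeless f edgeless =
  mk≃ (↔-refl ×-↔ f) λ (_ , x) (_ , y) → mk⇔ [ id , ⊥-elim ∘ edgeless x y ∘ proj₂ ] inj₁

Vec-∷↔× : ∀ {A : Set} {n} → Vec A (suc n) ↔ (A × Vec A n)
Vec-∷↔× = mk↔ₛ′ uncons (uncurry _∷_) (λ _ → refl) (λ { (_ ∷ _) → refl })

Vec-++↔× : ∀ {A : Set} m {n} → Vec A (m + n) ↔ (Vec A m × Vec A n)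
Vec-++↔× m = mk↔ₛ′ (λ xs → take m xs , drop m xs) (uncurry _++_)
  (λ (ys , zs) → let ys≡ , zs≡ = ++-injective _ ys (take++drop≡id m (ys ++ zs))
                 in cong₂ _,_ ys≡ zs≡)
  (take++drop≡id m)

Vec↔Fin^ : ∀ {q} n → Vec (Fin q) n ↔ Fin (q ^ n)
Vec↔Fin^ zero    = mk↔ₛ′ (λ _ → zero) (λ _ → []) (λ { zero → refl }) (λ { [] → refl })
Vec↔Fin^ (suc n) = ↔-trans Vec-∷↔× (↔-trans (↔-refl ×-↔ Vec↔Fin^ n) (↔-sym *↔×))

from-injective : ∀ {A B : Set} (f : A ↔ B) {x y} → from f x ≡ from f y → x ≡ y
from-injective f {x} {y} eq =
  trans (sym (strictlyInverseˡ f x)) (trans (cong (to f) eq) (strictlyInverseˡ f y))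

consWeight : ℕ → ℕ → ℕ
consWeight _       (suc w) = suc (suc w)
consWeight zero    zero    = 0
consWeight (suc _) zero    = 1

rtWeight-∷ : ∀ {n} (s : ℕ) (v : Vec ℕ n) → rtWeight (s ∷ v) ≡ consWeight s (rtWeight v)
rtWeight-∷ s v = begin
    indicator s ⊔ maxAll (tabulate (λ i → if lookup v i ≡ᵇ 0 then 0 else suc (suc (toℕ i))))
  ≡⟨ cong (λ t → indicator s ⊔ maxAll t) (tabulate-cong (λ i → shift-if (lookup v i ≡ᵇ 0))) ⟩
    indicator s ⊔ maxAll (tabulate (shift ∘ λ i → if lookup v i ≡ᵇ 0 then 0 else suc (toℕ i)))
  ≡⟨ cong (indicator s ⊔_) (maxAll-shift (λ i → if lookup v i ≡ᵇ 0 then 0 else suc (toℕ i))) ⟩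
    indicator s ⊔ shift (rtWeight v)
  ≡⟨ indicator-⊔-shift s (rtWeight v) ⟩
    consWeight s (rtWeight v)
  ∎
  where
  open ≡-Reasoning
  indicator : ℕ → ℕ
  indicator s = if s ≡ᵇ 0 then 0 else 1
  shift : ℕ → ℕ
  shift = consWeight 0
  maxAll : ∀ {n} → Vec ℕ n → ℕ
  maxAll = foldr _⊔_ 0 ∘ toList
  shift-if : ∀ b {t} → (if b then 0 else suc (suc t)) ≡ shift (if b then 0 else suc t)
  shift-if true  = refl
  shift-if false = refl
  shift-⊔ : ∀ x y → shift (x ⊔ y) ≡ shift x ⊔ shift y
  shift-⊔ zero    y       = refl
  shift-⊔ (suc x) zero    = refl
  shift-⊔ (suc x) (suc y) = refl
  maxAll-shift : ∀ {n} (g : Fin n → ℕ) → maxAll (tabulate (shift ∘ g)) ≡ shift (maxAll (tabulate g))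
  maxAll-shift {zero}  g = refl
  maxAll-shift {suc n} g =
    trans (cong (shift (g zero) ⊔_) (maxAll-shift (g ∘ Data.Fin.suc))) (sym (shift-⊔ (g zero) _))
  indicator-⊔-shift : ∀ s w → indicator s ⊔ shift w ≡ consWeight s w
  indicator-⊔-shift zero    zero    = refl
  indicator-⊔-shift (suc s) zero    = refl
  indicator-⊔-shift zero    (suc w) = refl
  indicator-⊔-shift (suc s) (suc w) = refl

consWeight≡0 : ∀ s w → consWeight s w ≡ 0 → s ≡ 0 × w ≡ 0
consWeight≡0 zero zero _ = refl , refl

consWeight-≤ : ∀ s {w n} → w ≤ n → consWeight s w ≤ suc n
consWeight-≤ _       {suc w} w≤n = s≤s w≤n
consWeight-≤ zero    {zero}  _   = z≤n
consWeight-≤ (suc _) {zero}  _   = s≤s z≤n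

subMod-self : ∀ q n → subMod q n n ≡ 0
subMod-self q n with n ≤ᵇ n in n≤ᵇn
... | true  = n∸n≡0 n
... | false = ⊥-elim (subst T n≤ᵇn (≤⇒≤ᵇ (≤-refl {n})))

subMod≡0⇒≡ : ∀ {q} (a b : Fin q) → subMod q (toℕ a) (toℕ b) ≡ 0 → a ≡ b
subMod≡0⇒≡ {q} a b a-b≡0 with toℕ b ≤ᵇ toℕ a in b≤ᵇa
... | true  = toℕ-injective (≤-antisym (m∸n≡0⇒m≤n a-b≡0) (≤ᵇ⇒≤ _ _ (subst T (sym b≤ᵇa) tt)))
... | false = ⊥-elim (<⇒≱ (<-≤-trans (toℕ<n b) (m≤m+n q (toℕ a))) (m∸n≡0⇒m≤n a-b≡0))

module _ {q : ℕ} where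

  rtDist-∷ : ∀ {n} (a b : Fin q) (x y : Vec (Fin q) n) →
             rtDist (a ∷ x) (b ∷ y) ≡ consWeight (subMod q (toℕ a) (toℕ b)) (rtDist x y)
  rtDist-∷ a b x y = rtWeight-∷ (subMod q (toℕ a) (toℕ b)) (vsub x y)

  rtDist-self : ∀ {n} (x : Vec (Fin q) n) → rtDist x x ≡ 0
  rtDist-self []      = refl
  rtDist-self (a ∷ x) rewrite rtDist-∷ a a x x | rtDist-self x | subMod-self q (toℕ a) = refl

  rtDist≡0⇒≡ : ∀ {n} (x y : Vec (Fin q) n) → rtDist x y ≡ 0 → x ≡ y
  rtDist≡0⇒≡ []      []      _     = refl
  rtDist≡0⇒≡ (a ∷ x) (b ∷ y) ρ≡0 =
    let a-b≡0 , ρxy≡0 = consWeight≡0 _ _ (trans (sym (rtDist-∷ a b x y)) ρ≡0)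
    in cong₂ _∷_ (subMod≡0⇒≡ a b a-b≡0) (rtDist≡0⇒≡ x y ρxy≡0)

  rtDist-≤ : ∀ {n} (x y : Vec (Fin q) n) → rtDist x y ≤ n
  rtDist-≤ []      []      = z≤n
  rtDist-≤ (a ∷ x) (b ∷ y) =
    subst (_≤ _) (sym (rtDist-∷ a b x y)) (consWeight-≤ _ (rtDist-≤ x y))

  rtDist-++-≡ : ∀ {m n} (l l′ : Vec (Fin q) m) (h : Vec (Fin q) n) →
                rtDist (l ++ h) (l′ ++ h) ≡ rtDist l l′
  rtDist-++-≡ []      []       h = rtDist-self h
  rtDist-++-≡ (a ∷ l) (b ∷ l′) h = begin
      rtDist (a ∷ l ++ h) (b ∷ l′ ++ h)
    ≡⟨ rtDist-∷ a b (l ++ h) (l′ ++ h) ⟩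
      consWeight (subMod q (toℕ a) (toℕ b)) (rtDist (l ++ h) (l′ ++ h))
    ≡⟨ cong (consWeight _) (rtDist-++-≡ l l′ h) ⟩
      consWeight (subMod q (toℕ a) (toℕ b)) (rtDist l l′)
    ≡⟨ rtDist-∷ a b l l′ ⟨
      rtDist (a ∷ l) (b ∷ l′)
    ∎
    where open ≡-Reasoning

  rtDist-++-≢ : ∀ {m n} (l l′ : Vec (Fin q) m) {h h′ : Vec (Fin q) n} → h ≢ h′ →
                rtDist (l ++ h) (l′ ++ h′) ≡ m + rtDist h h′
  rtDist-++-≢ {m} l l′ {h} {h′} h≢h′ with rtDist h h′ in ρ≡
  ... | zero  = ⊥-elim (h≢h′ (rtDist≡0⇒≡ h h′ ρ≡))
  ... | suc r = trans (prefix l l′) (sym (+-suc m r))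
    where
    -- a positive distance is not absorbed by consWeight, so each prefix coordinate adds one
    prefix : ∀ {m} (l l′ : Vec (Fin q) m) → rtDist (l ++ h) (l′ ++ h′) ≡ suc (m + r)
    prefix []      []       = ρ≡
    prefix (a ∷ l) (b ∷ l′) rewrite rtDist-∷ a b (l ++ h) (l′ ++ h′) | prefix l l′ = refl

rtGraph : (q m : ℕ) → (ℕ → Set) → Graph
rtGraph q m P = record { Vertex = Vec (Fin q) m ; Adj = λ x y → x ≢ y × P (rtDist x y) }

module _ {q : ℕ} {P : ℕ → Set} where

  rtGraph-++-≡ : ∀ {m n} (l l′ : Vec (Fin q) m) (h : Vec (Fin q) n) →
                 Adj (rtGraph q (m + n) P) (l ++ h) (l′ ++ h) ⇔ Adj (rtGraph q m P) l l′
  rtGraph-++-≡ l l′ h = mk⇔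
    (λ (l++h≢l′++h , p) → l++h≢l′++h ∘ cong (_++ h) , subst P (rtDist-++-≡ l l′ h) p)
    (λ (l≢l′ , p) → l≢l′ ∘ ++-injectiveˡ l l′ , subst P (sym (rtDist-++-≡ l l′ h)) p)

  rtGraph-++-≢ : ∀ {m n} (l l′ : Vec (Fin q) m) {h h′ : Vec (Fin q) n} → h ≢ h′ →
                 Σ ℕ λ r → m < r × r ≤ m + n × (Adj (rtGraph q (m + n) P) (l ++ h) (l′ ++ h′) ⇔ P r)
  rtGraph-++-≢ {m} l l′ {h} {h′} h≢h′ =
    m + rtDist h h′ ,
    m<m+n m (n≢0⇒n>0 (h≢h′ ∘ rtDist≡0⇒≡ h h′)) ,
    +-monoʳ-≤ m (rtDist-≤ h h′) ,
    mk⇔ (subst P ρ≡ ∘ proj₂) (λ p → h≢h′ ∘ ++-injectiveʳ l l′ , subst P (sym ρ≡) p)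
    where ρ≡ = rtDist-++-≢ l l′ h≢h′

  blocks : ∀ m n → Vec (Fin q) (m + n) ↔ (Fin (q ^ n) × Vec (Fin q) m)
  blocks m n = ↔-trans (Vec-++↔× m) (↔-trans (×-comm _ _) (Vec↔Fin^ n ×-↔ ↔-refl))

  rtGraph-copies : ∀ m n → (∀ r → m < r → r ≤ m + n → ¬ P r) →
                   rtGraph q (m + n) P ≃ copies (q ^ n) (rtGraph q m P)
  rtGraph-copies m n gap = mk≃′ (blocks m n) adj
    where
    adj : ∀ u v → Adj (rtGraph q (m + n) P) (from (blocks m n) u) (from (blocks m n) v) ⇔
                  Adj (copies (q ^ n) (rtGraph q m P)) u v
    adj (i , l) (j , l′) with i ≟ᶠ j
    ... | yes refl = ⇔.trans (rtGraph-++-≡ l l′ _) (mk⇔ (refl ,_) proj₂)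
    ... | no i≢j with rtGraph-++-≢ l l′ (i≢j ∘ from-injective (Vec↔Fin^ n))
    ...   | r , m<r , r≤m+n , adj⇔P =
      mk⇔ (⊥-elim ∘ gap r m<r r≤m+n ∘ Equivalence.to adj⇔P) (⊥-elim ∘ i≢j ∘ proj₁)

  rtGraph-join : ∀ m n → (∀ r → m < r → r ≤ m + n → P r) →
                 rtGraph q (m + n) P ≃ join (q ^ n) (rtGraph q m P)
  rtGraph-join m n full = mk≃′ (blocks m n) adj
    where
    adj : ∀ u v → Adj (rtGraph q (m + n) P) (from (blocks m n) u) (from (blocks m n) v) ⇔
                  Adj (join (q ^ n) (rtGraph q m P)) u v
    adj (i , l) (j , l′) with i ≟ᶠ j
    ... | yes refl =
      ⇔.trans (rtGraph-++-≡ l l′ _) (mk⇔ (inj₂ ∘ (refl ,_)) [ (λ i≢i → ⊥-elim (i≢i refl)) , proj₂ ])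
    ... | no i≢j with rtGraph-++-≢ l l′ (i≢j ∘ from-injective (Vec↔Fin^ n))
    ...   | r , m<r , r≤m+n , adj⇔P =
      mk⇔ (λ _ → inj₁ i≢j) (λ _ → Equivalence.from adj⇔P (full r m<r r≤m+n))

  rtGraph-join-last : ∀ m → P (suc m) → rtGraph q (suc m) P ≃ join q (rtGraph q m P)
  rtGraph-join-last m p =
    subst₂ (λ m′ q′ → rtGraph q m′ P ≃ join q′ (rtGraph q m P)) (+-comm m 1) (*-identityʳ q)
           (rtGraph-join m 1 λ r m<r r≤m+1 → subst P (≤-antisym m<r (subst (r ≤_) (+-comm m 1) r≤m+1)) p)

  rtGraph-edgeless : ∀ {m} → (∀ r → r ≤ m → ¬ P r) → ∀ x y → ¬ Adj (rtGraph q m P) x y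
  rtGraph-edgeless none x y (_ , p) = none _ (rtDist-≤ x y) p

  rtGraph-completeMultipartite : ∀ m → (∀ r → r ≤ m → ¬ P r) → P (suc m) →
                                 rtGraph q (suc m) P ≃ completeMultipartite q (q ^ m)
  rtGraph-completeMultipartite m none p =
    ≃-trans (rtGraph-join-last m p) (join-edgeless (Vec↔Fin^ m) (rtGraph-edgeless none))

  rtGraph-join-copies : ∀ m n → (∀ r → m < r → r ≤ m + n → ¬ P r) → P (suc (m + n)) →
                        rtGraph q (suc (m + n)) P ≃ join q (copies (q ^ n) (rtGraph q m P))
  rtGraph-join-copies m n gap p =
    ≃-trans (rtGraph-join-last (m + n) p) (join-cong (rtGraph-copies m n gap))

suc[m+[n∸m∸1]]≡n : ∀ {m n} → m < n → suc (m + (n ∸ m ∸ 1)) ≡ n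
suc[m+[n∸m∸1]]≡n {m} {n} m<n =
  trans (cong (λ t → suc (m + t)) (trans (∸-+-assoc n m 1) (cong (n ∸_) (+-comm m 1))))
        (m+[n∸m]≡n m<n)

-- distanceGraph q n k d is, by definition, rtGraph q n (Distances d k).
Distances : (ℕ → ℕ) → ℕ → ℕ → Set
Distances d k r = Σ ℕ λ i → i ≤ k × r ≡ d i

module _ {k : ℕ} {d : ℕ → ℕ} (increasing : ∀ i → i < k → d i < d (suc i)) where

  increasing⇒monotone : ∀ {i j} → i ≤ j → j ≤ k → d i ≤ d j
  increasing⇒monotone {i} {zero}  z≤n _   = ≤-refl
  increasing⇒monotone {i} {suc j} i≤1+j 1+j≤k with ≤-<-connex i j
  ... | inj₁ i≤j = ≤-trans (increasing⇒monotone i≤j (<⇒≤ 1+j≤k)) (<⇒≤ (increasing j 1+j≤k))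
  ... | inj₂ j<i = ≤-reflexive (cong d (≤-antisym i≤1+j j<i))

  below-first∉Distances : ∀ {r} → r < d 0 → ¬ Distances d k r
  below-first∉Distances r<d₀ (i , i≤k , refl) = <⇒≱ r<d₀ (increasing⇒monotone z≤n i≤k)

  between∉Distances : ∀ {j r} → j < k → d j < r → r < d (suc j) → ¬ Distances d k r
  between∉Distances {j} j<k dⱼ<r r<dⱼ₊₁ (i , i≤k , refl) with ≤-<-connex i j
  ... | inj₁ i≤j = <⇒≱ dⱼ<r (increasing⇒monotone i≤j (<⇒≤ j<k))
  ... | inj₂ j<i = <⇒≱ r<dⱼ₊₁ (increasing⇒monotone j<i i≤k)

  above-last∉Distances : ∀ {r} → d k < r → ¬ Distances d k r
  above-last∉Distances dₖ<r (i , i≤k , refl) = <⇒≱ dₖ<r (increasing⇒monotone i≤k ≤-refl)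

  rtGraph-Distances≃H : ∀ q → 1 ≤ d 0 → ∀ j → j ≤ k → rtGraph q (d j) (Distances d k) ≃ H q d j
  rtGraph-Distances≃H q 1≤d₀ zero _ =
    subst (λ m → rtGraph q m (Distances d k) ≃ H q d 0) d₀≡
      (rtGraph-completeMultipartite (d 0 ∸ 1)
        (λ r r≤ → below-first∉Distances (subst (r <_) d₀≡ (s≤s r≤)))
        (0 , z≤n , d₀≡))
    where d₀≡ = suc[m+[n∸m∸1]]≡n 1≤d₀
  rtGraph-Distances≃H q 1≤d₀ (suc j) 1+j≤k =
    subst (λ m → rtGraph q m (Distances d k) ≃ H q d (suc j)) dⱼ₊₁≡
      (≃-trans (rtGraph-join-copies (d j) _
                 (λ r dⱼ<r r≤ → between∉Distances 1+j≤k dⱼ<r (subst (r <_) dⱼ₊₁≡ (s≤s r≤)))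
                 (suc j , 1+j≤k , dⱼ₊₁≡))
               (join-cong (copies-cong (rtGraph-Distances≃H q 1≤d₀ j (<⇒≤ 1+j≤k)))))
    where dⱼ₊₁≡ = suc[m+[n∸m∸1]]≡n (increasing j 1+j≤k)

theorem3p1 : (q n k : ℕ) (d : ℕ → ℕ) →
    2 ≤ q → 1 ≤ n →
    1 ≤ d 0 → (∀ i → i < k → d i < d (suc i)) → d k ≤ n →
    distanceGraph q n k d ≅ copies (q ^ (n ∸ d k)) (H q d k)
theorem3p1 q n k d _ _ 1≤d₀ increasing dₖ≤n =
  ≃⇒≅ (subst (λ m → rtGraph q m (Distances d k) ≃ copies (q ^ (n ∸ d k)) (H q d k))
             (m+[n∸m]≡n dₖ≤n)
        (≃-trans (rtGraph-copies (d k) (n ∸ d k) λ _ dₖ<r _ → above-last∉Distances increasing dₖ<r)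
                 (copies-cong (rtGraph-Distances≃H increasing q 1≤d₀ k ≤-refl))))
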